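{- If a graph $G$ has an internal bisection, then its complement $\bar G$ has an external bisection.
   Context: Graphs are finite and simple; $\bar G$ is the complement of $G$. For $S\subseteq V$, $d_S(v)$ is the number of neighbors of $v$ in $S$ and $d(v)$ the degree (in the graph under consideration). A partition $(A,B)$ of $V$ with $A,B\ne\emptyset$ is internal if $d_A(x)\ge d(x)/2$ for all $x\in A$ and $d_B(x)\ge d(x)/2$ for all $x\in B$; it is external if $d_B(x)\ge d(x)/2$ for all $x\in A$ and $d_A(x)\ge d(x)/2$ for all $x\in B$. A bisection is a partition with $|A|=|B|$; an internal (external) bisection is an internal (external) partition that is a bisection. -}

module Defs where

open import Data.Nat using (ℕ; _+_; _*_; _≤_)
open import Data.Bool using (Bool; true; false; not; _∧_; if_then_else_)
open import Data.Fin using (Fin)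
open import Data.Vec.Functional using (Vector)
import Data.Vec.Functional as VF
open import Data.Product using (Σ; _×_; ∃)
open import Relation.Binary.PropositionalEquality using (_≡_; _≢_)

record Graph (n : ℕ) : Set where
  field
    adj   : Fin n → Fin n → Bool
    sym   : ∀ x y → adj x y ≡ adj y x
    irrefl : ∀ x → adj x x ≡ false
open Graph public

open import Data.Fin.Properties using (_≟_)
open import Relation.Nullary using (yes; no; Dec)
open import Relation.Nullary.Decidable using (⌊_⌋)
open import Relation.Binary.PropositionalEquality using (refl; cong)
import Relation.Binary.PropositionalEquality as Eq

complementAdj : ∀ {n} → Graph n → Fin n → Fin n → Bool
complementAdj G x y = not ⌊ x ≟ y ⌋ ∧ not (adj G x y)

complement : ∀ {n} → Graph n → Graph n
complement {n} G = record
  { adj = complementAdj G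
  ; sym = λ x y → Eq.cong₂ (λ a b → not a ∧ not b) (eqsym x y) (Graph.sym G x y)
  ; irrefl = λ x → irr x
  }
  where
  eqsym : ∀ (x y : Fin n) → ⌊ x ≟ y ⌋ ≡ ⌊ y ≟ x ⌋
  eqsym x y with x ≟ y | y ≟ x
  ... | yes _ | yes _ = refl
  ... | no _ | no _ = refl
  ... | yes p | no q = Data.Empty.⊥-elim (q (Eq.sym p)) where import Data.Empty
  ... | no p | yes q = Data.Empty.⊥-elim (p (Eq.sym q)) where import Data.Empty
  irr : ∀ x → not ⌊ x ≟ x ⌋ ∧ not (adj G x x) ≡ false
  irr x with x ≟ x
  ... | yes _ = refl
  ... | no ¬p = Data.Empty.⊥-elim (¬p refl) where import Data.Empty

count : ∀ {n} → (Fin n → Bool) → ℕ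
count f = VF.foldr (λ b k → (if b then 1 else 0) + k) 0 f

deg : ∀ {n} → Graph n → Fin n → ℕ
deg G v = count (adj G v)

degIn : ∀ {n} → Graph n → (Fin n → Bool) → Fin n → ℕ
degIn G S v = count (λ u → adj G v u ∧ S u)

-- A partition (A,B) of V is encoded by inA : Fin n → Bool
-- (A = {x | inA x ≡ true}, B = complement of A).
inB : ∀ {n} → (Fin n → Bool) → Fin n → Bool
inB inA x = not (inA x)

NonTrivial : ∀ {n} → (Fin n → Bool) → Set
NonTrivial inA = ∃ (λ a → inA a ≡ true) × ∃ (λ b → inA b ≡ false)

-- d_S(x) ≥ d(x)/2 is expressed as d(x) ≤ 2 * d_S(x).
IsInternal : ∀ {n} → Graph n → (Fin n → Bool) → Set
IsInternal G inA =
  NonTrivial inA ×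
  (∀ x → inA x ≡ true  → deg G x ≤ 2 * degIn G inA x) ×
  (∀ x → inA x ≡ false → deg G x ≤ 2 * degIn G (inB inA) x)

IsExternal : ∀ {n} → Graph n → (Fin n → Bool) → Set
IsExternal G inA =
  NonTrivial inA ×
  (∀ x → inA x ≡ true  → deg G x ≤ 2 * degIn G (inB inA) x) ×
  (∀ x → inA x ≡ false → deg G x ≤ 2 * degIn G inA x)

IsBisection : ∀ {n} → (Fin n → Bool) → Set
IsBisection inA = count inA ≡ count (inB inA)

HasInternalBisection : ∀ {n} → Graph n → Set
HasInternalBisection G = ∃ λ inA → IsInternal G inA × IsBisection inA

HasExternalBisection : ∀ {n} → Graph n → Set
HasExternalBisection G = ∃ λ inA → IsExternal G inA × IsBisection inA

-- Let x lie in the part T of a bisection (S , T) with |S| = |T| = n/2, and let a, b be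
-- its numbers of G-neighbours in T and in S. Internality at x means b ≤ a. In the
-- complement, x has n − 1 − (a + b) neighbours, of which |S| − b = n/2 − b lie in S, and
-- n − 1 − (a + b) ≤ 2 (n/2 − b) is exactly b ≤ a + 1. So the same bisection is external
-- in the complement.
module Submission where

open import Defs hiding (sym)
open import Data.Nat using (ℕ; zero; suc; _+_; _*_; _≤_; _<_; s≤s)
open import Data.Nat.Properties
  using (+-suc; +-identityʳ; +-monoˡ-≤; +-monoʳ-≤; +-cancelˡ-≤; +-cancelʳ-≤; <⇒≤;
         +-commutativeSemigroup; module ≤-Reasoning)
open import Algebra.Properties.CommutativeSemigroup +-commutativeSemigroup using (interchange)
open import Data.Bool using (Bool; true; false; not; _∧_; if_then_else_)
open import Data.Bool.Properties using (not-involutive)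
open import Data.Fin using (Fin)
import Data.Fin as Fin
open import Data.Fin.Properties using (_≟_; suc-injective)
open import Data.Product using (_,_)
open import Relation.Nullary using (yes; no)
open import Relation.Nullary.Decidable using (⌊_⌋; ⌊⌋-map′)
open import Relation.Binary.PropositionalEquality
  using (_≡_; refl; sym; trans; cong; cong₂; subst; module ≡-Reasoning)

ind : Bool → ℕ
ind b = if b then 1 else 0

ind-splitʳ : ∀ a b → ind (a ∧ b) + ind (a ∧ not b) ≡ ind a
ind-splitʳ false _     = refl
ind-splitʳ true  true  = refl
ind-splitʳ true  false = refl

ind-splitˡ : ∀ a b → ind (a ∧ b) + ind (not a ∧ b) ≡ ind b
ind-splitˡ true  false = refl
ind-splitˡ false false = refl
ind-splitˡ true  true  = refl
ind-splitˡ false true  = refl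

count-+ : ∀ {n} {f g h : Fin n → Bool} →
          (∀ u → ind (f u) + ind (g u) ≡ ind (h u)) → count f + count g ≡ count h
count-+ {zero}          _  = refl
count-+ {suc n} {f} {g} pw = begin
  (ind (f Fin.zero) + count (λ u → f (Fin.suc u))) + (ind (g Fin.zero) + count (λ u → g (Fin.suc u)))
    ≡⟨ interchange (ind (f Fin.zero)) _ (ind (g Fin.zero)) _ ⟩
  (ind (f Fin.zero) + ind (g Fin.zero)) + (count (λ u → f (Fin.suc u)) + count (λ u → g (Fin.suc u)))
    ≡⟨ cong₂ _+_ (pw Fin.zero) (count-+ (λ u → pw (Fin.suc u))) ⟩
  _ ∎
  where open ≡-Reasoning

count-cong : ∀ {n} {f g : Fin n → Bool} → (∀ u → f u ≡ g u) → count f ≡ count g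
count-cong {zero}  _   = refl
count-cong {suc n} f≗g = cong₂ (λ b k → ind b + k) (f≗g Fin.zero) (count-cong (λ u → f≗g (Fin.suc u)))

count-none : ∀ n → count {n} (λ _ → false) ≡ 0
count-none zero    = refl
count-none (suc n) = count-none n

count-all : ∀ n → count {n} (λ _ → true) ≡ n
count-all zero    = refl
count-all (suc n) = cong suc (count-all n)

-- ⌊_⌋ is isYes, which does not compute through the map′ in suc x ≟ suc u.
count-singleton : ∀ {n} (x : Fin n) → count (λ u → ⌊ x ≟ u ⌋) ≡ 1
count-singleton {suc n} Fin.zero    = cong suc (count-none n)
count-singleton {suc n} (Fin.suc x) =
  trans (count-cong (λ u → ⌊⌋-map′ (cong Fin.suc) suc-injective (x ≟ u))) (count-singleton x)

count-split : ∀ {n} (p q r : Fin n → Bool) → (∀ u → r u ≡ not (q u)) →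
              count (λ u → p u ∧ q u) + count (λ u → p u ∧ r u) ≡ count p
count-split p q r r≡¬q = count-+ pw
  where
  pw : ∀ u → ind (p u ∧ q u) + ind (p u ∧ r u) ≡ ind (p u)
  pw u rewrite r≡¬q u = ind-splitʳ (p u) (q u)

count-complementary : ∀ {n} (S T : Fin n → Bool) → (∀ u → T u ≡ not (S u)) →
                      count S + count T ≡ n
count-complementary {n} S T T≡¬S =
  subst (count S + count T ≡_) (count-all n) (count-split (λ _ → true) S T T≡¬S)

module _ {n : ℕ} (G : Graph n) where

  deg-split : (S T : Fin n → Bool) → (∀ u → T u ≡ not (S u)) →
              ∀ x → degIn G S x + degIn G T x ≡ deg G x
  deg-split S T T≡¬S x = count-split (adj G x) S T T≡¬S

  deg-complement : ∀ x → suc (deg G x + deg (complement G) x) ≡ n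
  deg-complement x = begin
    1 + (deg G x + deg (complement G) x)
      ≡⟨ cong (_+ (deg G x + deg (complement G) x)) (sym (count-singleton x)) ⟩
    count E + (deg G x + deg (complement G) x)
      ≡⟨ cong (count E +_) (count-+ pw) ⟩
    count E + count (λ u → not (E u))
      ≡⟨ count-complementary E (λ u → not (E u)) (λ _ → refl) ⟩
    n ∎
    where
    open ≡-Reasoning
    E : Fin n → Bool
    E u = ⌊ x ≟ u ⌋
    pw : ∀ u → ind (adj G x u) + ind (complementAdj G x u) ≡ ind (not (E u))
    pw u with x ≟ u
    ... | yes refl rewrite irrefl G x = refl
    ... | no _ = ind-splitʳ true (adj G x u)

  degIn-complement : ∀ S x → S x ≡ false →
                     degIn G S x + degIn (complement G) S x ≡ count S
  degIn-complement S x x∉S = count-+ pw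
    where
    pw : ∀ u → ind (adj G x u ∧ S u) + ind (complementAdj G x u ∧ S u) ≡ ind (S u)
    pw u with x ≟ u
    ... | yes refl rewrite x∉S | irrefl G x = refl
    ... | no _ = ind-splitˡ (adj G x u) (S u)

-- d̄, b̄: degree of x in the complement and its number of complement-neighbours in S;
-- a, b: its numbers of G-neighbours in its own part and in S.
complement-degree-bound : ∀ d̄ b̄ a b →
  suc ((b + a) + d̄) ≡ (b + b̄) + (b + b̄) → b + a ≤ 2 * a → d̄ < 2 * b̄
complement-degree-bound d̄ b̄ a b balance internal =
  +-cancelˡ-≤ (b + b) (suc d̄) (2 * b̄) (begin
    (b + b) + suc d̄    ≡⟨ +-suc (b + b) d̄ ⟩
    suc ((b + b) + d̄)  ≤⟨ s≤s (+-monoˡ-≤ d̄ (+-monoʳ-≤ b b≤a)) ⟩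
    suc ((b + a) + d̄)  ≡⟨ balance ⟩
    (b + b̄) + (b + b̄)  ≡⟨ interchange b b̄ b b̄ ⟩
    (b + b) + (b̄ + b̄)  ≡⟨ cong (λ k → (b + b) + (b̄ + k)) (sym (+-identityʳ b̄)) ⟩
    (b + b) + 2 * b̄    ∎)
  where
  open ≤-Reasoning
  b≤a : b ≤ a
  b≤a = +-cancelʳ-≤ a b a (subst (b + a ≤_) (cong (a +_) (+-identityʳ a)) internal)

internal⇒complement-external :
  ∀ {n} (G : Graph n) (S T : Fin n → Bool) → (∀ u → T u ≡ not (S u)) → count S ≡ count T →
  ∀ x → S x ≡ false → deg G x ≤ 2 * degIn G T x →
  deg (complement G) x ≤ 2 * degIn (complement G) S x
internal⇒complement-external {n} G S T T≡¬S bisection x x∉S internal =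
  <⇒≤ (complement-degree-bound (deg Ḡ x) (degIn Ḡ S x) (degIn G T x) (degIn G S x) balance
        (subst (_≤ 2 * degIn G T x) (sym (deg-split G S T T≡¬S x)) internal))
  where
  open ≡-Reasoning
  Ḡ : Graph n
  Ḡ = complement G
  balance : suc ((degIn G S x + degIn G T x) + deg Ḡ x)
          ≡ (degIn G S x + degIn Ḡ S x) + (degIn G S x + degIn Ḡ S x)
  balance = begin
    suc ((degIn G S x + degIn G T x) + deg Ḡ x)
      ≡⟨ cong (λ d → suc (d + deg Ḡ x)) (deg-split G S T T≡¬S x) ⟩
    suc (deg G x + deg Ḡ x)  ≡⟨ deg-complement G x ⟩
    n                        ≡⟨ sym (count-complementary S T T≡¬S) ⟩
    count S + count T        ≡⟨ cong (count S +_) (sym bisection) ⟩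
    count S + count S
      ≡⟨ sym (cong₂ _+_ (degIn-complement G S x x∉S) (degIn-complement G S x x∉S)) ⟩
    (degIn G S x + degIn Ḡ S x) + (degIn G S x + degIn Ḡ S x) ∎

corollary2 : ∀ (n : ℕ) (G : Graph n) → HasInternalBisection G → HasExternalBisection (complement G)
corollary2 n G (inA , (nonTrivial , internalA , internalB) , bisection) =
  inA , (nonTrivial , externalA , externalB) , bisection
  where
  externalA : ∀ x → inA x ≡ true → deg (complement G) x ≤ 2 * degIn (complement G) (inB inA) x
  externalA x x∈A = internal⇒complement-external G (inB inA) inA
    (λ u → sym (not-involutive (inA u))) (sym bisection) x (cong not x∈A) (internalA x x∈A)

  externalB : ∀ x → inA x ≡ false → deg (complement G) x ≤ 2 * degIn (complement G) inA x
  externalB x x∉A = internal⇒complement-external G inA (inB inA)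
    (λ _ → refl) bisection x x∉A (internalB x x∉A)
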